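{- Let $\widetilde G=(I,P;E)$ be a pinned $d$-isostatic graph and $p$ a generic configuration. Suppose that for every edge $e\in E$, the pinned framework $(\widetilde G-e,p)$ has an infinitesimal motion $U$ with $U_i\neq0$ for every inner vertex $i\in I$. Then $\widetilde G$ is strongly $d$-Assur.
   Context: Fix $d\ge1$. A pinned graph $\widetilde G=(I,P;E)$ has disjoint finite sets $I$ (inner) and $P$ (pinned) of vertices and a finite multiset $E$ of edges, each an unordered pair of distinct vertices with at least one endpoint in $I$; $\widetilde G-e$ denotes the pinned graph with edge $e$ deleted. A configuration $p$ assigns $p_v\in\mathbb R^d$ to each vertex. The pinned rigidity matrix $R(\widetilde G,p)$ is the $|E|\times d|I|$ matrix with one row per edge and $d$ columns per inner vertex: the row of $\{i,j\}$, $i,j\in I$, has $p_i-p_j$ in the columns of $i$, $p_j-p_i$ in the columns of $j$, zeros elsewhere; the row of $\{i,k\}$, $i\in I$, $k\in P$, has $p_i-p_k$ in the columns of $i$, zeros elsewhere. An infinitesimal motion is $U=(U_i)_{i\in I}$, $U_i\in\mathbb R^d$, with $R(\widetilde G,p)U=0$. $p$ is generic if it lies in the open dense set where the pinned rigidity matrix attains maximum rank. $\widetilde G$ is pinned $d$-isostatic if for some (equivalently every generic) $p$ the matrix $R(\widetilde G,p)$ is square and invertible; it is $d$-Assur if additionally it has no pinned $d$-isostatic subgraph $(I',P';E')$ with $\emptyset\ne I'\subsetneq I$. A $d$-Assur graph is strongly $d$-Assur if, at a generic configuration $p$, removal of any edge $e$ leaves a framework $(\widetilde G-e,p)$ with an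 infinitesimal motion that is nonzero at every inner vertex.
   Formalization: Configurations p and infinitesimal motions U take values in ℚ^d rather than ℝ^d, and genericity means attaining the maximum rank among rational configurations. -}

module Defs where

open import Data.Nat using (ℕ; zero; suc; _<_) renaming (_*_ to _*ℕ_)
open import Data.Fin using (Fin; zero; suc; punchIn; _≟_)
open import Data.Sum using (_⊎_; inj₁; inj₂)
open import Data.Product using (Σ; ∃; _×_; _,_; proj₁; proj₂)
open import Data.Unit using (⊤)
open import Data.Empty using (⊥)
open import Data.List using (List; length; lookup; removeAt)
open import Data.List.Relation.Unary.All using (All)
open import Data.Rational using (ℚ; 0ℚ; 1ℚ; _+_; _*_; -_; _-_)
open import Relation.Binary.PropositionalEquality using (_≡_; _≢_)
open import Relation.Nullary using (¬_; yes; no)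
open import Function.Definitions using (Injective)

Σℚ : ∀ {n} → (Fin n → ℚ) → ℚ
Σℚ {zero}  f = 0ℚ
Σℚ {suc n} f = f zero + Σℚ (λ j → f (suc j))

sgn : ∀ {n} → Fin n → ℚ
sgn zero    = 1ℚ
sgn (suc j) = - sgn j

det : ∀ {n} → (Fin n → Fin n → ℚ) → ℚ
det {zero}  M = 1ℚ
det {suc n} M =
  Σℚ (λ j → sgn j * (M zero j * det (λ a b → M (suc a) (punchIn j b))))

-- Pinned graphs: inner vertices Fin nI, pinned vertices Fin nP,
-- edges a list (multiset) of pairs of vertices.

Vertex : ℕ → ℕ → Set
Vertex nI nP = Fin nI ⊎ Fin nP

Edge : ℕ → ℕ → Set
Edge nI nP = Vertex nI nP × Vertex nI nP

record PinnedGraph : Set where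
  constructor pinned
  field
    nI    : ℕ
    nP    : ℕ
    edges : List (Edge nI nP)
open PinnedGraph public

IsInner : ∀ {nI nP} → Vertex nI nP → Set
IsInner (inj₁ _) = ⊤
IsInner (inj₂ _) = ⊥

-- an edge is an (unordered) pair of distinct vertices, at least one inner
ValidEdge : ∀ {nI nP} → Edge nI nP → Set
ValidEdge (u , w) = u ≢ w × (IsInner u ⊎ IsInner w)

IsPinnedGraph : PinnedGraph → Set
IsPinnedGraph G = All ValidEdge (edges G)

_-ᵉ_ : (G : PinnedGraph) → Fin (length (edges G)) → PinnedGraph
G -ᵉ e = pinned (nI G) (nP G) (removeAt (edges G) e)

Config : ℕ → PinnedGraph → Set
Config d G = Vertex (nI G) (nP G) → Fin d → ℚ

InnerVec : ℕ → PinnedGraph → Set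
InnerVec d G = Fin (nI G) → Fin d → ℚ

contrib : ∀ {d nI nP} → (Vertex nI nP → Fin d → ℚ) →
          Vertex nI nP → Vertex nI nP → Fin nI → Fin d → ℚ
contrib p (inj₁ a) w i c with a ≟ i
... | yes _ = p (inj₁ a) c - p w c
... | no  _ = 0ℚ
contrib p (inj₂ _) w i c = 0ℚ

-- the row of edge {u,w}: p_u - p_w in columns of u (if inner),
-- p_w - p_u in columns of w (if inner), zeros elsewhere
rowEntry : ∀ {d nI nP} → (Vertex nI nP → Fin d → ℚ) →
           Edge nI nP → Fin nI → Fin d → ℚ
rowEntry p (u , w) i c = contrib p u w i c + contrib p w u i c

RigidityMatrix : (d : ℕ) (G : PinnedGraph) → Config d G →
                 Fin (length (edges G)) → Fin (nI G) → Fin d → ℚ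
RigidityMatrix d G p r = rowEntry p (lookup (edges G) r)

applyR : (d : ℕ) (G : PinnedGraph) → Config d G → InnerVec d G →
         Fin (length (edges G)) → ℚ
applyR d G p U r = Σℚ (λ i → Σℚ (λ c → RigidityMatrix d G p r i c * U i c))

IsInfMotion : (d : ℕ) (G : PinnedGraph) → Config d G → InnerVec d G → Set
IsInfMotion d G p U = ∀ r → applyR d G p U r ≡ 0ℚ

NonzeroVec : ∀ {d} → (Fin d → ℚ) → Set
NonzeroVec {d} v = Σ (Fin d) λ c → v c ≢ 0ℚ

SquareInvertible : (d : ℕ) (G : PinnedGraph) → Config d G → Set
SquareInvertible d G p =
  (length (edges G) ≡ d *ℕ nI G) ×
  (∀ U → IsInfMotion d G p U → ∀ i c → U i c ≡ 0ℚ)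

RankAtLeast : (d : ℕ) (G : PinnedGraph) → Config d G → ℕ → Set
RankAtLeast d G p r =
  Σ (Fin r → Fin (length (edges G))) λ ρ →
  Σ (Fin r → Fin (nI G) × Fin d) λ γ →
    Injective _≡_ _≡_ ρ × Injective _≡_ _≡_ γ ×
    (det (λ a b → RigidityMatrix d G p (ρ a) (proj₁ (γ b)) (proj₂ (γ b))) ≢ 0ℚ)

Generic : (d : ℕ) (G : PinnedGraph) → Config d G → Set
Generic d G p = ∀ (q : Config d G) (r : ℕ) → RankAtLeast d G q r → RankAtLeast d G p r

PinnedIsostatic : ℕ → PinnedGraph → Set
PinnedIsostatic d G = IsPinnedGraph G × Σ (Config d G) λ p → SquareInvertible d G p

mapVertex : ∀ {nI nP nI' nP'} → (Fin nI' → Fin nI) → (Fin nP' → Fin nP) →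
            Vertex nI' nP' → Vertex nI nP
mapVertex ι κ (inj₁ i) = inj₁ (ι i)
mapVertex ι κ (inj₂ k) = inj₂ (κ k)

mapEdge : ∀ {nI nP nI' nP'} → (Fin nI' → Fin nI) → (Fin nP' → Fin nP) →
          Edge nI' nP' → Edge nI nP
mapEdge ι κ (u , w) = mapVertex ι κ u , mapVertex ι κ w

-- H = (I',P';E') is a pinned subgraph of G: I' ⊆ I, P' ⊆ P, E' ⊆ E (as multisets)
record IsPinnedSubgraph (H G : PinnedGraph) : Set where
  field
    ι     : Fin (nI H) → Fin (nI G)
    ι-inj : Injective _≡_ _≡_ ι
    κ     : Fin (nP H) → Fin (nP G)
    κ-inj : Injective _≡_ _≡_ κ
    σ     : Fin (length (edges H)) → Fin (length (edges G))
    σ-inj : Injective _≡_ _≡_ σ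
    σ-ok  : ∀ k → lookup (edges G) (σ k) ≡ mapEdge ι κ (lookup (edges H) k)

IsAssur : ℕ → PinnedGraph → Set
IsAssur d G =
  PinnedIsostatic d G ×
  ¬ (Σ PinnedGraph λ H → IsPinnedSubgraph H G × 0 < nI H × nI H < nI G ×
       PinnedIsostatic d H)

IsStronglyAssur : ℕ → PinnedGraph → Set
IsStronglyAssur d G =
  IsAssur d G ×
  Σ (Config d G) λ p → Generic d G p ×
    (∀ e → Σ (InnerVec d G) λ U →
       IsInfMotion d (G -ᵉ e) p U × (∀ i → NonzeroVec (U i)))

-- Suppose H ⊆ G were a proper pinned isostatic subgraph. It has d·|I_H| < d·|I| = |E|
-- edges, so some edge e of G is not an edge of H. Since G is isostatic, R(G,q) is invertible for some q,
-- so a maximal minor of R(G,q) is nonzero, hence (p generic) so is one of R(G,p): the rows of R(G,p)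
-- are independent, i.e. R(G,p) is onto. Rows of R(G,p) coming from edges of H only involve inner
-- vertices of H, so R(H,p|H) is onto as well; being square, it is injective. A motion U of (G - e,p)
-- restricts to a motion of (H,p|H), so U vanishes on the inner vertices of H, contradicting the
-- hypothesis. The linear algebra over ℚ (for square matrices: det ≠ 0 ⇒ onto ⇒ trivial kernel ⇒ det ≠ 0)
-- comes from Gaussian elimination by column operations on the Laplace-expansion determinant.

module Submission where

open import Defs
open import Data.Nat using (ℕ; _≤_)
open import Data.Fin using (Fin)
open import Data.List using (length)
open import Data.Product using (Σ; _×_)

open import Level using (0ℓ)
import Data.Nat as ℕ
open import Data.Nat using (zero; suc)
import Data.Nat.Properties as ℕP
open import Data.Fin as Fin using (zero; suc; punchIn; punchOut; inject₁; toℕ; fromℕ<; _≟_; _↑ˡ_; _↑ʳ_)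
import Data.Fin.Properties as FinP
import Data.Fin.Permutation as Perm
open import Data.Rational using (ℚ; 0ℚ; 1ℚ; _+_; _*_; -_; _-_; 1/_; ≢-nonZero)
import Data.Rational.Properties as ℚP
open import Data.Product using (∃; _,_; proj₁; proj₂)
open import Data.Sum using (_⊎_; inj₁; inj₂)
open import Data.Empty using (⊥-elim)
open import Data.List as List using (List; lookup; removeAt)
open import Data.Vec.Functional using (updateAt; _∷_)
open import Data.Vec.Functional.Properties
  using (updateAt-updates; updateAt-minimal; updateAt-id-local; updateAt-commutes)
open import Function using (_∘_; id; const)
open import Function.Definitions using (Injective)
open import Relation.Binary.PropositionalEquality
open import Relation.Binary.Definitions using (tri<; tri≈; tri>)
open import Relation.Nullary using (¬_; yes; no)
open import Relation.Nullary.Decidable using (¬?; decidable-stable)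
open import Relation.Nullary.Decidable.Core using (dec⇒maybe)
import Algebra.Properties.CommutativeMonoid.Sum as MonoidSum
open import Tactic.RingSolver using (solve-∀)
import Tactic.RingSolver.Core.AlmostCommutativeRing as ACR

open ≡-Reasoning

ℚ-ring : ACR.AlmostCommutativeRing 0ℓ 0ℓ
ℚ-ring = ACR.fromCommutativeRing ℚP.+-*-commutativeRing (λ x → dec⇒maybe (0ℚ ℚP.≟ x))

injective-avoiding⇒< : ∀ {m n} {f : Fin m → Fin n} → Injective _≡_ _≡_ f →
                       ∀ y → (∀ x → f x ≢ y) → m ℕ.< n
injective-avoiding⇒< {n = suc n} {f} f-inj y f≢y = ℕ.s≤s (FinP.injective⇒≤ {f = f′} f′-inj)
  where
  f′ : Fin _ → Fin n
  f′ x = punchOut (f≢y x ∘ sym)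
  f′-inj : Injective _≡_ _≡_ f′
  f′-inj eq = f-inj (FinP.punchOut-injective (f≢y _ ∘ sym) (f≢y _ ∘ sym) eq)

injective⇒surjective : ∀ {n} {f : Fin n → Fin n} → Injective _≡_ _≡_ f → ∀ y → ∃ λ x → f x ≡ y
injective⇒surjective {f = f} f-inj y with FinP.any? (λ x → f x ≟ y)
... | yes hit  = hit
... | no ¬hit  = ⊥-elim (ℕP.<-irrefl refl (injective-avoiding⇒< f-inj y (λ x eq → ¬hit (x , eq))))

injective-<⇒avoids : ∀ {m n} {f : Fin m → Fin n} → Injective _≡_ _≡_ f → m ℕ.< n →
                     ∃ λ y → ∀ x → f x ≢ y
injective-<⇒avoids {m} {n} {f} f-inj m<n with FinP.any? (λ y → FinP.all? (λ x → ¬? (f x ≟ y)))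
... | yes avoided = avoided
... | no ¬avoided = ⊥-elim (ℕP.<⇒≱ m<n (FinP.injective⇒≤ {f = proj₁ ∘ preimage} preimage-inj))
  where
  preimage : ∀ y → ∃ λ x → f x ≡ y
  preimage y with FinP.¬∀⟶∃¬ m (λ x → f x ≢ y) (λ x → ¬? (f x ≟ y)) (λ avoid → ¬avoided (y , avoid))
  ... | x , ¬f≢y = x , decidable-stable (f x ≟ y) ¬f≢y
  preimage-inj : Injective _≡_ _≡_ (proj₁ ∘ preimage)
  preimage-inj {y} {y′} eq = trans (sym (proj₂ (preimage y))) (trans (cong f eq) (proj₂ (preimage y′)))

Σℚ-cong : ∀ {n} {f g : Fin n → ℚ} → (∀ i → f i ≡ g i) → Σℚ f ≡ Σℚ g
Σℚ-cong {zero}  f≗g = refl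
Σℚ-cong {suc n} f≗g = cong₂ _+_ (f≗g zero) (Σℚ-cong (f≗g ∘ suc))

Σℚ-zero : ∀ {n} {f : Fin n → ℚ} → (∀ i → f i ≡ 0ℚ) → Σℚ f ≡ 0ℚ
Σℚ-zero {zero}  f≗0 = refl
Σℚ-zero {suc n} f≗0 = cong₂ _+_ (f≗0 zero) (Σℚ-zero (f≗0 ∘ suc))

Σℚ-+ : ∀ {n} (f g : Fin n → ℚ) → Σℚ (λ i → f i + g i) ≡ Σℚ f + Σℚ g
Σℚ-+ {zero}  f g = refl
Σℚ-+ {suc n} f g =
  trans (cong (f zero + g zero +_) (Σℚ-+ (f ∘ suc) (g ∘ suc)))
        (interchange (f zero) (g zero) (Σℚ (f ∘ suc)) (Σℚ (g ∘ suc)))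
  where
  interchange : ∀ a b c d → (a + b) + (c + d) ≡ (a + c) + (b + d)
  interchange = solve-∀ ℚ-ring

Σℚ-*ˡ : ∀ {n} α (f : Fin n → ℚ) → Σℚ (λ i → α * f i) ≡ α * Σℚ f
Σℚ-*ˡ {zero}  α f = sym (ℚP.*-zeroʳ α)
Σℚ-*ˡ {suc n} α f =
  trans (cong (α * f zero +_) (Σℚ-*ˡ α (f ∘ suc))) (sym (ℚP.*-distribˡ-+ α (f zero) (Σℚ (f ∘ suc))))

Σℚ-punchIn : ∀ {n} (f : Fin (suc n) → ℚ) j → Σℚ f ≡ f j + Σℚ (f ∘ punchIn j)
Σℚ-punchIn f       zero    = refl
Σℚ-punchIn {suc n} f (suc j) =
  trans (cong (f zero +_) (Σℚ-punchIn (f ∘ suc) j))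
        (swap (f zero) (f (suc j)) (Σℚ (f ∘ suc ∘ punchIn j)))
  where
  swap : ∀ a b c → a + (b + c) ≡ b + (a + c)
  swap = solve-∀ ℚ-ring

Σℚ-single : ∀ {n} (f : Fin n → ℚ) j → (∀ k → k ≢ j → f k ≡ 0ℚ) → Σℚ f ≡ f j
Σℚ-single {suc n} f j f-vanishes = begin
  Σℚ f                          ≡⟨ Σℚ-punchIn f j ⟩
  f j + Σℚ (f ∘ punchIn j)      ≡⟨ cong (f j +_) (Σℚ-zero (λ k → f-vanishes _ (FinP.punchInᵢ≢i j k))) ⟩
  f j + 0ℚ                      ≡⟨ ℚP.+-identityʳ (f j) ⟩
  f j                           ∎

Σℚ-two : ∀ {n} (f : Fin n → ℚ) j₁ j₂ → j₁ ≢ j₂ →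
          (∀ k → k ≢ j₁ → k ≢ j₂ → f k ≡ 0ℚ) → Σℚ f ≡ f j₁ + f j₂
Σℚ-two {suc n} f j₁ j₂ j₁≢j₂ f-vanishes = begin
  Σℚ f                           ≡⟨ Σℚ-punchIn f j₁ ⟩
  f j₁ + Σℚ (f ∘ punchIn j₁)     ≡⟨ cong (f j₁ +_) (Σℚ-single (f ∘ punchIn j₁) j₂′ rest) ⟩
  f j₁ + f (punchIn j₁ j₂′)      ≡⟨ cong (λ k → f j₁ + f k) (FinP.punchIn-punchOut j₁≢j₂) ⟩
  f j₁ + f j₂                    ∎
  where
  j₂′ : Fin n
  j₂′ = punchOut j₁≢j₂
  rest : ∀ k → k ≢ j₂′ → f (punchIn j₁ k) ≡ 0ℚ
  rest k k≢j₂′ = f-vanishes _ (FinP.punchInᵢ≢i j₁ k) λ eq →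
    k≢j₂′ (FinP.punchIn-injective j₁ k j₂′ (trans eq (sym (FinP.punchIn-punchOut j₁≢j₂))))

Σℚ-differ : ∀ {n} (f g : Fin n → ℚ) c → (∀ k → k ≢ c → g k ≡ f k) →
            Σℚ g ≡ Σℚ f + (g c - f c)
Σℚ-differ {suc n} f g c g≗f = begin
  Σℚ g                                   ≡⟨ Σℚ-punchIn g c ⟩
  g c + Σℚ (g ∘ punchIn c)               ≡⟨ cong (g c +_) (Σℚ-cong (λ k → g≗f _ (FinP.punchInᵢ≢i c k))) ⟩
  g c + Σℚ (f ∘ punchIn c)               ≡⟨ shift (g c) (f c) _ ⟩
  (f c + Σℚ (f ∘ punchIn c)) + (g c - f c) ≡⟨ cong (_+ (g c - f c)) (Σℚ-punchIn f c) ⟨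
  Σℚ f + (g c - f c)                     ∎
  where
  shift : ∀ a b s → a + s ≡ (b + s) + (a - b)
  shift = solve-∀ ℚ-ring

Σℚ-comm : ∀ {m n} (f : Fin m → Fin n → ℚ) →
          Σℚ (λ h → Σℚ (f h)) ≡ Σℚ (λ i → Σℚ (λ h → f h i))
Σℚ-comm {zero} {n} f = sym (Σℚ-zero {n} (λ i → refl))
Σℚ-comm {suc m} f =
  trans (cong (Σℚ (f zero) +_) (Σℚ-comm (f ∘ suc))) (sym (Σℚ-+ (f zero) _))

module ℚ-Sum = MonoidSum ℚP.+-0-commutativeMonoid

Σℚ≡sum : ∀ {n} (f : Fin n → ℚ) → Σℚ f ≡ ℚ-Sum.sum f
Σℚ≡sum {zero}  f = refl
Σℚ≡sum {suc n} f = cong (f zero +_) (Σℚ≡sum (f ∘ suc))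

Σℚ-permute : ∀ {n} {π : Fin n → Fin n} → Injective _≡_ _≡_ π → ∀ f → Σℚ (f ∘ π) ≡ Σℚ f
Σℚ-permute {π = π} π-inj f = begin
  Σℚ (f ∘ π)          ≡⟨ Σℚ≡sum (f ∘ π) ⟩
  ℚ-Sum.sum (f ∘ π)   ≡⟨ ℚ-Sum.sum-permute f (Perm.permutation π π⁻¹ π-π⁻¹ (π-inj ∘ π-π⁻¹ ∘ π)) ⟨
  ℚ-Sum.sum f         ≡⟨ Σℚ≡sum f ⟨
  Σℚ f                ∎
  where
  π⁻¹ : Fin _ → Fin _
  π⁻¹ = proj₁ ∘ injective⇒surjective π-inj
  π-π⁻¹ : ∀ y → π (π⁻¹ y) ≡ y
  π-π⁻¹ = proj₂ ∘ injective⇒surjective π-inj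

Σℚ-cast : ∀ {m n} (m≡n : m ≡ n) (f : Fin n → ℚ) → Σℚ (f ∘ Fin.cast m≡n) ≡ Σℚ f
Σℚ-cast refl f = Σℚ-cong (λ b → cong f (FinP.cast-is-id refl b))

Σℚ-++ : ∀ m n (f : Fin (m ℕ.+ n) → ℚ) → Σℚ f ≡ Σℚ (λ i → f (i ↑ˡ n)) + Σℚ (λ j → f (m ↑ʳ j))
Σℚ-++ zero    n f = sym (ℚP.+-identityˡ (Σℚ f))
Σℚ-++ (suc m) n f = trans (cong (f zero +_) (Σℚ-++ m n (f ∘ suc))) (sym (ℚP.+-assoc (f zero) _ _))

Σℚ-combine : ∀ {m n} (f : Fin (m ℕ.* n) → ℚ) →
             Σℚ f ≡ Σℚ (λ i → Σℚ (λ c → f (Fin.combine {m} {n} i c)))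
Σℚ-combine {zero}      f = refl
Σℚ-combine {suc m} {n} f =
  trans (Σℚ-++ n (m ℕ.* n) f)
        (cong (Σℚ (λ c → f (c ↑ˡ (m ℕ.* n))) +_) (Σℚ-combine {m} (λ y → f (n ↑ʳ y))))

Σℚ-image : ∀ {m n} (ι : Fin m → Fin n) → Injective _≡_ _≡_ ι → (F : Fin n → ℚ) →
           (∀ i → (∀ h → ι h ≢ i) → F i ≡ 0ℚ) → Σℚ F ≡ Σℚ (F ∘ ι)
Σℚ-image {m} {n} ι ι-inj F F-outside = begin
  Σℚ F                             ≡⟨ Σℚ-cong column ⟨
  Σℚ (λ i → Σℚ (λ h → spike h i))  ≡⟨ Σℚ-comm spike ⟨
  Σℚ (λ h → Σℚ (spike h))          ≡⟨ Σℚ-cong row ⟩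
  Σℚ (F ∘ ι)                       ∎
  where
  spike : Fin m → Fin n → ℚ
  spike h = updateAt (const 0ℚ) (ι h) (const (F (ι h)))
  row : ∀ h → Σℚ (spike h) ≡ F (ι h)
  row h = trans (Σℚ-single (spike h) (ι h) (λ i i≢ιh → updateAt-minimal i (ι h) (const 0ℚ) i≢ιh))
                (updateAt-updates (ι h) (const 0ℚ))
  column : ∀ i → Σℚ (λ h → spike h i) ≡ F i
  column i with FinP.any? (λ h → ι h ≟ i)
  ... | yes (h₀ , refl) =
    trans (Σℚ-single (λ h → spike h (ι h₀)) h₀
             (λ h h≢h₀ → updateAt-minimal (ι h₀) (ι h) (const 0ℚ) (h≢h₀ ∘ ι-inj ∘ sym)))
          (updateAt-updates (ι h₀) (const 0ℚ))
  ... | no ¬hit = trans (Σℚ-zero (λ h → updateAt-minimal i (ι h) (const 0ℚ) (λ eq → ¬hit (h , sym eq))))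
                        (sym (F-outside i (λ h eq → ¬hit (h , eq))))

-- Determinants

Matrix : ℕ → Set
Matrix n = Fin n → Fin n → ℚ

minor : ∀ {n} → Matrix (suc n) → Fin (suc n) → Matrix n
minor M j a b = M (suc a) (punchIn j b)

det-cong : ∀ {n} {M M′ : Matrix n} → (∀ a b → M a b ≡ M′ a b) → det M ≡ det M′
det-cong {zero}  M≗M′ = refl
det-cong {suc n} M≗M′ = Σℚ-cong λ j →
  cong₂ (λ x y → sgn j * (x * y)) (M≗M′ zero j) (det-cong (λ a b → M≗M′ (suc a) (punchIn j b)))

setColumn : ∀ {n} → Matrix n → Fin n → (Fin n → ℚ) → Matrix n
setColumn M c v a = updateAt (M a) c (const (v a))

minor-setColumn-same : ∀ {n} (M : Matrix (suc n)) c v a b →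
                       minor (setColumn M c v) c a b ≡ minor M c a b
minor-setColumn-same M c v a b = updateAt-minimal _ c (M (suc a)) (FinP.punchInᵢ≢i c b)

minor-setColumn-other : ∀ {n} (M : Matrix (suc n)) c v j (j≢c : j ≢ c) a b →
  minor (setColumn M c v) j a b ≡ setColumn (minor M j) (punchOut j≢c) (v ∘ suc) a b
minor-setColumn-other M c v j j≢c a b with b ≟ punchOut j≢c
... | yes refl = trans (cong (updateAt (M (suc a)) c _) (FinP.punchIn-punchOut j≢c))
                       (trans (updateAt-updates c (M (suc a))) (sym (updateAt-updates b (minor M j a))))
... | no b≢c′ = trans (updateAt-minimal _ c (M (suc a)) punchIn≢c)
                      (sym (updateAt-minimal b _ (minor M j a) b≢c′))
  where
  punchIn≢c : punchIn j b ≢ c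
  punchIn≢c eq = b≢c′ (FinP.punchIn-injective j b _ (trans eq (sym (FinP.punchIn-punchOut j≢c))))

det-linear : ∀ {n} (M : Matrix n) c α (x y : Fin n → ℚ) →
             det (setColumn M c (λ a → α * x a + y a)) ≡
             α * det (setColumn M c x) + det (setColumn M c y)
det-linear {suc n} M c α x y = begin
  Σℚ (term z)                               ≡⟨ Σℚ-cong term-linear ⟩
  Σℚ (λ j → α * term x j + term y j)        ≡⟨ Σℚ-+ (λ j → α * term x j) (term y) ⟩
  Σℚ (λ j → α * term x j) + Σℚ (term y)     ≡⟨ cong (_+ Σℚ (term y)) (Σℚ-*ˡ α (term x)) ⟩
  α * Σℚ (term x) + Σℚ (term y)             ∎
  where
  z : Fin (suc n) → ℚ
  z a = α * x a + y a
  term : (Fin (suc n) → ℚ) → Fin (suc n) → ℚ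
  term v j = sgn j * (setColumn M c v zero j * det (minor (setColumn M c v) j))
  term-linear : ∀ j → term z j ≡ α * term x j + term y j
  term-linear j with j ≟ c
  ... | yes refl = trans (term≡ z) (trans (distrib α (sgn j) (x zero) (y zero) D)
                          (sym (cong₂ (λ s t → α * s + t) (term≡ x) (term≡ y))))
    where
    D : ℚ
    D = det (minor M j)
    term≡ : ∀ v → term v j ≡ sgn j * (v zero * D)
    term≡ v = cong₂ (λ e m → sgn j * (e * m)) (updateAt-updates j (M zero))
                    (det-cong (minor-setColumn-same M j v))
    distrib : ∀ α s a b d → s * ((α * a + b) * d) ≡ α * (s * (a * d)) + s * (b * d)
    distrib = solve-∀ ℚ-ring
  ... | no j≢c = trans (term≡ z) (trans (cong (λ e → sgn j * (M zero j * e))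
                          (det-linear (minor M j) c′ α (x ∘ suc) (y ∘ suc)))
                   (trans (distrib α (sgn j) (M zero j) (D x) (D y))
                          (sym (cong₂ (λ s t → α * s + t) (term≡ x) (term≡ y)))))
    where
    c′ : Fin n
    c′ = punchOut j≢c
    D : (Fin (suc n) → ℚ) → ℚ
    D v = det (setColumn (minor M j) c′ (v ∘ suc))
    term≡ : ∀ v → term v j ≡ sgn j * (M zero j * D v)
    term≡ v = cong₂ (λ e m → sgn j * (e * m)) (updateAt-minimal j c (M zero) j≢c)
                    (det-cong (minor-setColumn-other M c v j j≢c))
    distrib : ∀ α s m a b → s * (m * (α * a + b)) ≡ α * (s * (m * a)) + s * (m * b)
    distrib = solve-∀ ℚ-ring

det-additive : ∀ {n} (M : Matrix n) c (x y : Fin n → ℚ) →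
               det (setColumn M c (λ a → x a + y a)) ≡ det (setColumn M c x) + det (setColumn M c y)
det-additive M c x y = begin
  det (setColumn M c (λ a → x a + y a))
    ≡⟨ det-cong (λ a b → cong (λ e → updateAt (M a) c (const (e + y a)) b) (sym (ℚP.*-identityˡ (x a)))) ⟩
  det (setColumn M c (λ a → 1ℚ * x a + y a))
    ≡⟨ det-linear M c 1ℚ x y ⟩
  1ℚ * det (setColumn M c x) + det (setColumn M c y)
    ≡⟨ cong (_+ det (setColumn M c y)) (ℚP.*-identityˡ (det (setColumn M c x))) ⟩
  det (setColumn M c x) + det (setColumn M c y)
    ∎

det-setColumn-self : ∀ {n} (M : Matrix n) c → det (setColumn M c (λ a → M a c)) ≡ det M
det-setColumn-self M c = det-cong (λ a → updateAt-id-local c (M a) refl)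

sgn-inject₁ : ∀ {n} (j : Fin n) → sgn (inject₁ j) ≡ sgn j
sgn-inject₁ zero    = refl
sgn-inject₁ (suc j) = cong -_ (sgn-inject₁ j)

inject₁≢suc : ∀ {n} (j : Fin n) → inject₁ j ≢ suc j
inject₁≢suc (suc j) eq = inject₁≢suc j (FinP.suc-injective eq)

punchIn-adjacent : ∀ {n} (j b : Fin n) →
  punchIn (inject₁ j) b ≡ punchIn (suc j) b ⊎
  (punchIn (inject₁ j) b ≡ suc j × punchIn (suc j) b ≡ inject₁ j)
punchIn-adjacent zero    zero    = inj₂ (refl , refl)
punchIn-adjacent zero    (suc b) = inj₁ refl
punchIn-adjacent (suc j) zero    = inj₁ refl
punchIn-adjacent (suc j) (suc b) with punchIn-adjacent j b
... | inj₁ eq          = inj₁ (cong suc eq)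
... | inj₂ (eq₁ , eq₂) = inj₂ (cong suc eq₁ , cong suc eq₂)

adjacent-punchIn : ∀ {m} (k : Fin (suc (suc m))) (j : Fin (suc m)) → k ≢ inject₁ j → k ≢ suc j →
  Σ (Fin m) λ j′ → punchIn k (inject₁ j′) ≡ inject₁ j × punchIn k (suc j′) ≡ suc j
adjacent-punchIn zero          zero     k≢j _    = ⊥-elim (k≢j refl)
adjacent-punchIn {suc m} zero  (suc j)  _   _    = j , refl , refl
adjacent-punchIn (suc zero)    zero     _   k≢sj = ⊥-elim (k≢sj refl)
adjacent-punchIn {suc m} (suc (suc k)) zero _ _  = zero , refl , refl
adjacent-punchIn {suc m} (suc k) (suc j) k≢j k≢sj
  with j′ , eq₁ , eq₂ ← adjacent-punchIn k j (k≢j ∘ cong suc) (k≢sj ∘ cong suc)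
  = suc j′ , cong suc eq₁ , cong suc eq₂

det-adjacentEqual : ∀ {n} (M : Matrix (suc n)) (j : Fin n) →
                    (∀ a → M a (inject₁ j) ≡ M a (suc j)) → det M ≡ 0ℚ
det-adjacentEqual {suc n} M j equal = begin
  Σℚ term                              ≡⟨ Σℚ-two term (inject₁ j) (suc j) (inject₁≢suc j) others ⟩
  term (inject₁ j) + term (suc j)      ≡⟨ cong (_+ term (suc j)) (cong₂ _*_ (sgn-inject₁ j)
                                            (cong₂ _*_ (equal zero) (det-cong same-minor))) ⟩
  sgn j * E + (- sgn j) * E            ≡⟨ cancel (sgn j) E ⟩
  0ℚ                                   ∎
  where
  term : Fin (suc (suc n)) → ℚ
  term k = sgn k * (M zero k * det (minor M k))
  E : ℚ
  E = M zero (suc j) * det (minor M (suc j))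
  cancel : ∀ s e → s * e + (- s) * e ≡ 0ℚ
  cancel = solve-∀ ℚ-ring
  others : ∀ k → k ≢ inject₁ j → k ≢ suc j → term k ≡ 0ℚ
  others k k≢j k≢sj with j′ , eq₁ , eq₂ ← adjacent-punchIn k j k≢j k≢sj =
    trans (cong (λ e → sgn k * (M zero k * e)) (det-adjacentEqual (minor M k) j′ λ a →
            trans (cong (M (suc a)) eq₁) (trans (equal (suc a)) (cong (M (suc a)) (sym eq₂)))))
          (trans (cong (sgn k *_) (ℚP.*-zeroʳ (M zero k))) (ℚP.*-zeroʳ (sgn k)))
  same-minor : ∀ a b → minor M (inject₁ j) a b ≡ minor M (suc j) a b
  same-minor a b with punchIn-adjacent j b
  ... | inj₁ eq          = cong (M (suc a)) eq
  ... | inj₂ (eq₁ , eq₂) = trans (cong (M (suc a)) eq₁)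
                             (trans (sym (equal (suc a))) (cong (M (suc a)) (sym eq₂)))

swapAdjacent : ∀ {n} → Matrix (suc n) → Fin n → Matrix (suc n)
swapAdjacent M j = setColumn (setColumn M (inject₁ j) (λ a → M a (suc j))) (suc j) (λ a → M a (inject₁ j))

-- Expand 0 = det (X+Y | X+Y) by additivity in both columns.
det-swapAdjacent : ∀ {n} (M : Matrix (suc n)) j → det (swapAdjacent M j) ≡ - det M
det-swapAdjacent M j = solve (begin
  0ℚ                                   ≡⟨ equal (λ a → X a + Y a) ⟨
  det (B (X ⊕ Y) (X ⊕ Y))              ≡⟨ det-additive (setColumn M c₁ (X ⊕ Y)) c₂ X Y ⟩
  det (B (X ⊕ Y) X) + det (B (X ⊕ Y) Y) ≡⟨ cong₂ _+_ (additive₁ X) (additive₁ Y) ⟩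
  (det (B X X) + det (B Y X)) + (det (B X Y) + det (B Y Y))
    ≡⟨ cong₂ (λ s t → (s + det (B Y X)) + (det (B X Y) + t)) (equal X) (equal Y) ⟩
  (0ℚ + det (B Y X)) + (det (B X Y) + 0ℚ)
    ≡⟨ cong (λ t → (0ℚ + det (B Y X)) + (t + 0ℚ)) (det-cong unchanged) ⟩
  (0ℚ + det (B Y X)) + (det M + 0ℚ)    ∎)
  where
  c₁ c₂ : Fin _
  c₁ = inject₁ j
  c₂ = suc j
  X Y : Fin _ → ℚ
  X a = M a c₁
  Y a = M a c₂
  _⊕_ : (Fin _ → ℚ) → (Fin _ → ℚ) → Fin _ → ℚ
  (u ⊕ v) a = u a + v a
  B : (Fin _ → ℚ) → (Fin _ → ℚ) → Matrix _
  B u v = setColumn (setColumn M c₁ u) c₂ v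
  commute : ∀ u v a b → B u v a b ≡ setColumn (setColumn M c₂ v) c₁ u a b
  commute u v a = updateAt-commutes c₂ c₁ (inject₁≢suc j ∘ sym) (M a)
  additive₁ : ∀ w → det (B (X ⊕ Y) w) ≡ det (B X w) + det (B Y w)
  additive₁ w = trans (det-cong (commute (X ⊕ Y) w))
    (trans (det-additive (setColumn M c₂ w) c₁ X Y)
           (sym (cong₂ _+_ (det-cong (commute X w)) (det-cong (commute Y w)))))
  equal : ∀ w → det (B w w) ≡ 0ℚ
  equal w = det-adjacentEqual (B w w) j λ a →
    trans (updateAt-minimal c₁ c₂ (setColumn M c₁ w a) (inject₁≢suc j))
          (trans (updateAt-updates c₁ (M a)) (sym (updateAt-updates c₂ (setColumn M c₁ w a))))
  unchanged : ∀ a b → B X Y a b ≡ M a b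
  unchanged a b with b ≟ c₂
  ... | yes refl = updateAt-updates b (setColumn M c₁ X a)
  ... | no b≢c₂  = trans (updateAt-minimal b c₂ (setColumn M c₁ X a) b≢c₂) (updateAt-id-local c₁ (M a) refl b)
  solve : 0ℚ ≡ (0ℚ + det (B Y X)) + (det M + 0ℚ) → det (swapAdjacent M j) ≡ - det M
  solve h = trans (isolate (det (B Y X)) (det M)) (trans (cong (_- det M) (sym h)) (ℚP.+-identityˡ (- det M)))
    where
    isolate : ∀ t m → t ≡ ((0ℚ + t) + (m + 0ℚ)) - m
    isolate = solve-∀ ℚ-ring

-- Induction on toℕ c₂ = k: swapping columns j and j + 1 moves the copy at c₂ = j + 1 one step left.
det-equalColumns-< : ∀ k {n} (M : Matrix n) c₁ c₂ → toℕ c₂ ≡ k → c₁ Fin.< c₂ →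
                     (∀ a → M a c₁ ≡ M a c₂) → det M ≡ 0ℚ
det-equalColumns-< (suc k) {suc n} M c₁ (suc j) c₂≡k c₁<c₂ equal
  with ℕP.m≤n⇒m<n∨m≡n (ℕ.s≤s⁻¹ c₁<c₂)
... | inj₂ c₁≡j = det-adjacentEqual M j λ a → trans (cong (M a) (sym c₁≡inject₁j)) (equal a)
  where
  c₁≡inject₁j : c₁ ≡ inject₁ j
  c₁≡inject₁j = FinP.toℕ-injective (trans c₁≡j (sym (FinP.toℕ-inject₁ j)))
... | inj₁ c₁<j = ℚP.neg-injective (begin
  - det M                  ≡⟨ det-swapAdjacent M j ⟨
  det (swapAdjacent M j)   ≡⟨ det-equalColumns-< k (swapAdjacent M j) c₁ (inject₁ j)
                                (trans (FinP.toℕ-inject₁ j) (ℕP.suc-injective c₂≡k)) c₁<inject₁j swapped ⟩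
  0ℚ                       ∎)
  where
  c₁<inject₁j : c₁ Fin.< inject₁ j
  c₁<inject₁j = subst (toℕ c₁ ℕ.<_) (sym (FinP.toℕ-inject₁ j)) c₁<j
  c₁≢inject₁j : c₁ ≢ inject₁ j
  c₁≢inject₁j eq = ℕP.<-irrefl (cong toℕ eq) c₁<inject₁j
  c₁≢suc-j : c₁ ≢ suc j
  c₁≢suc-j eq = ℕP.<-irrefl (cong toℕ eq) c₁<c₂
  swapped : ∀ a → swapAdjacent M j a c₁ ≡ swapAdjacent M j a (inject₁ j)
  swapped a = begin
    swapAdjacent M j a c₁                                      ≡⟨ updateAt-minimal c₁ (suc j) _ c₁≢suc-j ⟩
    setColumn M (inject₁ j) (λ b → M b (suc j)) a c₁           ≡⟨ updateAt-minimal c₁ (inject₁ j) (M a) c₁≢inject₁j ⟩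
    M a c₁                                                     ≡⟨ equal a ⟩
    M a (suc j)                                                ≡⟨ updateAt-updates (inject₁ j) (M a) ⟨
    setColumn M (inject₁ j) (λ b → M b (suc j)) a (inject₁ j)  ≡⟨ updateAt-minimal (inject₁ j) (suc j) _ (inject₁≢suc j) ⟨
    swapAdjacent M j a (inject₁ j)                             ∎

det-equalColumns : ∀ {n} (M : Matrix n) c₁ c₂ → c₁ ≢ c₂ → (∀ a → M a c₁ ≡ M a c₂) → det M ≡ 0ℚ
det-equalColumns M c₁ c₂ c₁≢c₂ equal with FinP.<-cmp c₁ c₂
... | tri< c₁<c₂ _ _ = det-equalColumns-< (toℕ c₂) M c₁ c₂ refl c₁<c₂ equal
... | tri≈ _ c₁≡c₂ _ = ⊥-elim (c₁≢c₂ c₁≡c₂)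
... | tri> _ _ c₂<c₁ = det-equalColumns-< (toℕ c₁) M c₂ c₁ refl c₂<c₁ (sym ∘ equal)

addColumn : ∀ {n} → Matrix n → (c c′ : Fin n) → ℚ → Matrix n
addColumn M c c′ α = setColumn M c (λ a → α * M a c′ + M a c)

det-addColumn : ∀ {n} (M : Matrix n) c c′ α → c ≢ c′ → det (addColumn M c c′ α) ≡ det M
det-addColumn M c c′ α c≢c′ = begin
  det (addColumn M c c′ α)                     ≡⟨ det-linear M c α (λ a → M a c′) (λ a → M a c) ⟩
  α * det (setColumn M c (λ a → M a c′)) + det (setColumn M c (λ a → M a c))
                                               ≡⟨ cong₂ (λ s t → α * s + t) copied (det-setColumn-self M c) ⟩
  α * 0ℚ + det M                               ≡⟨ cong (_+ det M) (ℚP.*-zeroʳ α) ⟩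
  0ℚ + det M                                   ≡⟨ ℚP.+-identityˡ (det M) ⟩
  det M                                        ∎
  where
  copied : det (setColumn M c (λ a → M a c′)) ≡ 0ℚ
  copied = det-equalColumns _ c c′ c≢c′ λ a →
    trans (updateAt-updates c (M a)) (sym (updateAt-minimal c′ c (M a) (c≢c′ ∘ sym)))

-- Square linear systems

*-cancelˡ-≡0 : ∀ x {y} → x ≢ 0ℚ → x * y ≡ 0ℚ → y ≡ 0ℚ
*-cancelˡ-≡0 x {y} x≢0 xy≡0 = begin
  y                ≡⟨ ℚP.*-identityˡ y ⟨
  1ℚ * y           ≡⟨ cong (_* y) (ℚP.*-inverseˡ x) ⟨
  1/ x * x * y     ≡⟨ ℚP.*-assoc (1/ x) x y ⟩
  1/ x * (x * y)   ≡⟨ cong (1/ x *_) xy≡0 ⟩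
  1/ x * 0ℚ        ≡⟨ ℚP.*-zeroʳ (1/ x) ⟩
  0ℚ               ∎
  where instance _ = ≢-nonZero x≢0

infix 8 _·_
_·_ : ∀ {n} → Matrix n → (Fin n → ℚ) → Fin n → ℚ
(M · v) a = Σℚ (λ b → M a b * v b)

·-cong : ∀ {n} (M : Matrix n) {v w : Fin n → ℚ} → (∀ b → v b ≡ w b) → ∀ a → (M · v) a ≡ (M · w) a
·-cong M v≗w a = Σℚ-cong (λ b → cong (M a b *_) (v≗w b))

Solves : ∀ {n} → Matrix n → (Fin n → ℚ) → (Fin n → ℚ) → Set
Solves M v t = ∀ a → (M · v) a ≡ t a

IsZero : ∀ {n} → (Fin n → ℚ) → Set
IsZero v = ∀ b → v b ≡ 0ℚ

TrivialKernel Onto : ∀ {n} → Matrix n → Set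
TrivialKernel M = ∀ v → Solves M v (const 0ℚ) → IsZero v
Onto {n} M = ∀ t → Σ (Fin n → ℚ) λ v → Solves M v t

Nonsingular Singular : ∀ {n} → Matrix n → Set
Nonsingular M = det M ≢ 0ℚ × TrivialKernel M × Onto M
Singular {n} M =
  det M ≡ 0ℚ ×
  (Σ (Fin n → ℚ) λ v → Solves M v (const 0ℚ) × ¬ IsZero v) ×
  (Σ (Fin n → ℚ) λ t → ∀ v → ¬ Solves M v t)

module AddColumn {n} (M : Matrix n) (c c′ : Fin n) (α : ℚ) (c≢c′ : c ≢ c′) where

  shift : ℚ → (Fin n → ℚ) → Fin n → ℚ
  shift β v = updateAt v c′ (_+ β * v c)

  shift-c : ∀ β v → shift β v c ≡ v c
  shift-c β v = updateAt-minimal c c′ v c≢c′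

  ·-shift : ∀ v a → (addColumn M c c′ α · v) a ≡ (M · shift α v) a
  ·-shift v a = begin
    (addColumn M c c′ α · v) a
      ≡⟨ Σℚ-differ _ _ c (λ k k≢c → cong (_* v k) (updateAt-minimal k c (M a) k≢c)) ⟩
    (M · v) a + (addColumn M c c′ α a c * v c - M a c * v c)
      ≡⟨ cong (λ e → (M · v) a + (e * v c - M a c * v c)) (updateAt-updates c (M a)) ⟩
    (M · v) a + ((α * M a c′ + M a c) * v c - M a c * v c)
      ≡⟨ move α ((M · v) a) (M a c) (M a c′) (v c) (v c′) ⟩
    (M · v) a + (M a c′ * (v c′ + α * v c) - M a c′ * v c′)
      ≡⟨ cong (λ e → (M · v) a + (M a c′ * e - M a c′ * v c′)) (updateAt-updates c′ v) ⟨
    (M · v) a + (M a c′ * shift α v c′ - M a c′ * v c′)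
      ≡⟨ Σℚ-differ _ _ c′ (λ k k≢c′ → cong (M a k *_) (updateAt-minimal k c′ v k≢c′)) ⟨
    (M · shift α v) a
      ∎
    where
    move : ∀ α s m m′ x x′ → s + ((α * m′ + m) * x - m * x) ≡ s + (m′ * (x′ + α * x) - m′ * x′)
    move = solve-∀ ℚ-ring

  shift-shift : ∀ β γ → (∀ x y → x + β * y + γ * y ≡ x) → ∀ v b → shift γ (shift β v) b ≡ v b
  shift-shift β γ cancel v b with b ≟ c′
  ... | yes refl = trans (updateAt-updates b (shift β v))
                         (trans (cong₂ (λ x y → x + γ * y) (updateAt-updates b v) (shift-c β v)) (cancel (v b) (v c)))
  ... | no b≢c′  = trans (updateAt-minimal b c′ (shift β v) b≢c′) (updateAt-minimal b c′ v b≢c′)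

  shift-zero : ∀ β v → IsZero v → IsZero (shift β v)
  shift-zero β v v≡0 b with b ≟ c′
  ... | yes refl = trans (updateAt-updates b v) (trans (cong₂ (λ x y → x + β * y) (v≡0 b) (v≡0 c))
                                                      (trans (ℚP.+-identityˡ (β * 0ℚ)) (ℚP.*-zeroʳ β)))
  ... | no b≢c′  = trans (updateAt-minimal b c′ v b≢c′) (v≡0 b)

  shift-shift-neg : ∀ v b → shift α (shift (- α) v) b ≡ v b
  shift-shift-neg = shift-shift (- α) α (cancel α)
    where
    cancel : ∀ α x y → x + - α * y + α * y ≡ x
    cancel = solve-∀ ℚ-ring

  shift-neg-shift : ∀ v b → shift (- α) (shift α v) b ≡ v b
  shift-neg-shift = shift-shift α (- α) (cancel α)
    where
    cancel : ∀ α x y → x + α * y + - α * y ≡ x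
    cancel = solve-∀ ℚ-ring

  transfer : Nonsingular (addColumn M c c′ α) ⊎ Singular (addColumn M c c′ α) → Nonsingular M ⊎ Singular M
  transfer (inj₁ (det≢0 , kernel , onto)) = inj₁
    ( det≢0 ∘ trans (det-addColumn M c c′ α c≢c′)
    , (λ v Mv≡0 b → begin
        v b                         ≡⟨ shift-shift-neg v b ⟨
        shift α (shift (- α) v) b   ≡⟨ shift-zero α _ (kernel _ (λ a → trans (·-shift _ a)
                                         (trans (·-cong M (shift-shift-neg v) a) (Mv≡0 a)))) b ⟩
        0ℚ                          ∎)
    , (λ t → let v , solves = onto t in shift α v , λ a → trans (sym (·-shift v a)) (solves a)) )
  transfer (inj₂ (det≡0 , (v , v-kernel , v≢0) , (t , unsolvable))) = inj₂
    ( trans (sym (det-addColumn M c c′ α c≢c′)) det≡0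
    , (shift α v , (λ a → trans (sym (·-shift v a)) (v-kernel a))
                 , λ shifted≡0 → v≢0 λ b →
                     trans (sym (shift-neg-shift v b)) (shift-zero (- α) _ shifted≡0 b))
    , (t , λ w solves → unsolvable (shift (- α) w) λ a →
         trans (·-shift _ a) (trans (·-cong M (shift-shift-neg w) a) (solves a))) )

·-suc : ∀ {n} (M : Matrix (suc n)) v → v zero ≡ 0ℚ → ∀ r → (M · v) (suc r) ≡ (minor M zero · (v ∘ suc)) r
·-suc M v v₀≡0 r = begin
  M (suc r) zero * v zero + rest ≡⟨ cong (λ x → M (suc r) zero * x + rest) v₀≡0 ⟩
  M (suc r) zero * 0ℚ + rest     ≡⟨ cong (_+ rest) (ℚP.*-zeroʳ (M (suc r) zero)) ⟩
  0ℚ + rest                      ≡⟨ ℚP.+-identityˡ rest ⟩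
  rest                           ∎
  where
  rest : ℚ
  rest = (minor M zero · (v ∘ suc)) r

det-zeroTail : ∀ {n} (M : Matrix (suc n)) → (∀ b → M zero (suc b) ≡ 0ℚ) →
               det M ≡ M zero zero * det (minor M zero)
det-zeroTail M tail≡0 =
  trans (cong (1ℚ * (M zero zero * det (minor M zero)) +_) (Σℚ-zero λ j →
          trans (cong (λ e → sgn (suc j) * (e * det (minor M (suc j)))) (tail≡0 j))
                (kill (sgn (suc j)) (det (minor M (suc j))))))
        (simplify _)
  where
  kill : ∀ s d → s * (0ℚ * d) ≡ 0ℚ
  kill = solve-∀ ℚ-ring
  simplify : ∀ x → 1ℚ * x + 0ℚ ≡ x
  simplify = solve-∀ ℚ-ring

zeroRow-singular : ∀ {n} (M : Matrix (suc n)) → (∀ c → M zero c ≡ 0ℚ) →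
                   Nonsingular (minor M zero) ⊎ Singular (minor M zero) → Singular M
zeroRow-singular {n} M row≡0 rest =
  ( trans (det-zeroTail M (row≡0 ∘ suc))
          (trans (cong (_* det (minor M zero)) (row≡0 zero)) (ℚP.*-zeroˡ (det (minor M zero))))
  , kernelVector rest
  , (1ℚ ∷ const 0ℚ) , λ v solves → 0≢1 (trans (sym (·-row v)) (solves zero)) )
  where
  0≢1 : 0ℚ ≢ 1ℚ
  0≢1 ()
  ·-row : ∀ v → (M · v) zero ≡ 0ℚ
  ·-row v = Σℚ-zero λ b → trans (cong (_* v b) (row≡0 b)) (ℚP.*-zeroˡ (v b))
  kernelVector : Nonsingular (minor M zero) ⊎ Singular (minor M zero) →
                 Σ (Fin (suc n) → ℚ) λ v → Solves M v (const 0ℚ) × ¬ IsZero v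
  kernelVector (inj₁ (_ , _ , onto)) with w , solves ← onto (λ r → - M (suc r) zero) =
    (1ℚ ∷ w) , (λ { zero → ·-row (1ℚ ∷ w)
                  ; (suc r) → trans (cong (M (suc r) zero * 1ℚ +_) (solves r)) (cancel (M (suc r) zero)) })
             , λ v≡0 → 0≢1 (sym (v≡0 zero))
    where
    cancel : ∀ m → m * 1ℚ + - m ≡ 0ℚ
    cancel = solve-∀ ℚ-ring
  kernelVector (inj₂ (_ , (w , w-kernel , w≢0) , _)) =
    (0ℚ ∷ w) , (λ { zero → ·-row (0ℚ ∷ w)
                  ; (suc r) → trans (·-suc M (0ℚ ∷ w) refl r) (w-kernel r) })
             , λ v≡0 → w≢0 (v≡0 ∘ suc)

module Pivot {n} (M : Matrix (suc n)) (pivot≢0 : M zero zero ≢ 0ℚ) (tail≡0 : ∀ b → M zero (suc b) ≡ 0ℚ) where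

  ·-zero : ∀ v → (M · v) zero ≡ M zero zero * v zero
  ·-zero v = trans (cong (M zero zero * v zero +_)
                      (Σℚ-zero λ b → trans (cong (_* v (suc b)) (tail≡0 b)) (ℚP.*-zeroˡ (v (suc b)))))
                   (ℚP.+-identityʳ _)

  first≡0 : ∀ v → (M · v) zero ≡ 0ℚ → v zero ≡ 0ℚ
  first≡0 v Mv₀≡0 = *-cancelˡ-≡0 (M zero zero) pivot≢0 (trans (sym (·-zero v)) Mv₀≡0)

  transfer : Nonsingular (minor M zero) ⊎ Singular (minor M zero) → Nonsingular M ⊎ Singular M
  transfer (inj₁ (det≢0 , kernel , onto)) = inj₁
    ( (λ det≡0 → det≢0 (*-cancelˡ-≡0 (M zero zero) pivot≢0 (trans (sym (det-zeroTail M tail≡0)) det≡0)))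
    , (λ { v Mv≡0 zero → first≡0 v (Mv≡0 zero)
         ; v Mv≡0 (suc b) → kernel (v ∘ suc)
                              (λ r → trans (sym (·-suc M v (first≡0 v (Mv≡0 zero)) r)) (Mv≡0 (suc r))) b })
    , solve )
    where
    solve : Onto M
    solve t =
      (v₀ ∷ w) , λ { zero → trans (·-zero (v₀ ∷ w)) pivot-solves
                   ; (suc r) → trans (cong (M (suc r) zero * v₀ +_) (solves r))
                                     (cancel (M (suc r) zero * v₀) (t (suc r))) }
      where
      instance _ = ≢-nonZero pivot≢0
      v₀ : ℚ
      v₀ = 1/ M zero zero * t zero
      reduced : Σ (Fin n → ℚ) λ w → Solves (minor M zero) w (λ r → t (suc r) - M (suc r) zero * v₀)
      reduced = onto _
      w : Fin n → ℚ
      w = proj₁ reduced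
      solves : Solves (minor M zero) w (λ r → t (suc r) - M (suc r) zero * v₀)
      solves = proj₂ reduced
      pivot-solves : M zero zero * v₀ ≡ t zero
      pivot-solves = trans (sym (ℚP.*-assoc (M zero zero) _ (t zero)))
                       (trans (cong (_* t zero) (ℚP.*-inverseʳ (M zero zero))) (ℚP.*-identityˡ (t zero)))
      cancel : ∀ x y → x + (y - x) ≡ y
      cancel = solve-∀ ℚ-ring
  transfer (inj₂ (det≡0 , (w , w-kernel , w≢0) , (t , unsolvable))) = inj₂
    ( trans (det-zeroTail M tail≡0) (trans (cong (M zero zero *_) det≡0) (ℚP.*-zeroʳ (M zero zero)))
    , ( (0ℚ ∷ w)
      , (λ { zero → trans (·-zero (0ℚ ∷ w)) (ℚP.*-zeroʳ (M zero zero))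
           ; (suc r) → trans (·-suc M (0ℚ ∷ w) refl r) (w-kernel r) })
      , λ v≡0 → w≢0 (v≡0 ∘ suc) )
    , ( (0ℚ ∷ t)
      , λ v solves → unsolvable (v ∘ suc) λ r →
          trans (sym (·-suc M v (first≡0 v (solves zero)) r)) (solves (suc r)) ) )

-- Gaussian elimination on the first row, clearing the entries right of the pivot from the last one down.
clearRow : ∀ {n} k → k ℕ.≤ n → (M : Matrix (suc n)) → M zero zero ≢ 0ℚ →
           (∀ b → k ℕ.≤ toℕ b → M zero (suc b) ≡ 0ℚ) → Nonsingular M ⊎ Singular M
nonsingular-or-singular : ∀ {n} (M : Matrix n) → Nonsingular M ⊎ Singular M

clearRow zero _ M pivot≢0 cleared =
  Pivot.transfer M pivot≢0 (λ b → cleared b ℕ.z≤n) (nonsingular-or-singular (minor M zero))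
clearRow (suc k) k<n M pivot≢0 cleared =
  AddColumn.transfer M (suc b₀) zero α (λ ())
    (clearRow k (ℕP.<⇒≤ k<n) M′ pivot≢0 cleared′)
  where
  instance _ = ≢-nonZero pivot≢0
  b₀ : Fin _
  b₀ = fromℕ< k<n
  α : ℚ
  α = - (M zero (suc b₀) * 1/ M zero zero)
  M′ : Matrix _
  M′ = addColumn M (suc b₀) zero α
  eliminated : M′ zero (suc b₀) ≡ 0ℚ
  eliminated = begin
    M′ zero (suc b₀)                        ≡⟨ updateAt-updates (suc b₀) (M zero) ⟩
    α * M zero zero + m                     ≡⟨ regroup m (1/ M zero zero) (M zero zero) ⟩
    m - m * (1/ M zero zero * M zero zero)  ≡⟨ cong (λ e → m - m * e) (ℚP.*-inverseˡ (M zero zero)) ⟩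
    m - m * 1ℚ                              ≡⟨ vanish m ⟩
    0ℚ                                      ∎
    where
    m : ℚ
    m = M zero (suc b₀)
    regroup : ∀ m i a → - (m * i) * a + m ≡ m - m * (i * a)
    regroup = solve-∀ ℚ-ring
    vanish : ∀ m → m - m * 1ℚ ≡ 0ℚ
    vanish = solve-∀ ℚ-ring
  cleared′ : ∀ b → k ℕ.≤ toℕ b → M′ zero (suc b) ≡ 0ℚ
  cleared′ b k≤b with b ≟ b₀
  ... | yes refl = eliminated
  ... | no b≢b₀ = trans (updateAt-minimal (suc b) (suc b₀) (M zero) (b≢b₀ ∘ FinP.suc-injective))
                        (cleared b (ℕP.≤∧≢⇒< k≤b (λ k≡b → b≢b₀ (FinP.toℕ-injective
                           (trans (sym k≡b) (sym (FinP.toℕ-fromℕ< k<n)))))))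

eliminate : ∀ {n} (M : Matrix (suc n)) → M zero zero ≢ 0ℚ → Nonsingular M ⊎ Singular M
eliminate {n} M pivot≢0 =
  clearRow n ℕP.≤-refl M pivot≢0 (λ b n≤b → ⊥-elim (ℕP.<⇒≱ (FinP.toℕ<n b) n≤b))

nonsingular-or-singular {zero} M = inj₁ ((λ ()) , (λ _ _ ()) , λ _ → (λ ()) , λ ())
nonsingular-or-singular {suc n} M with FinP.all? (λ c → M zero c ℚP.≟ 0ℚ)
... | yes row≡0 = inj₂ (zeroRow-singular M row≡0 (nonsingular-or-singular (minor M zero)))
... | no row≢0 with FinP.¬∀⟶∃¬-smallest _ _ (λ c → M zero c ℚP.≟ 0ℚ) row≢0
...   | zero , pivot≢0 , _ = eliminate M pivot≢0
...   | suc c , entry≢0 , before≡0 =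
  AddColumn.transfer M zero (suc c) 1ℚ (λ ()) (eliminate (addColumn M zero (suc c) 1ℚ) pivot≢0)
  where
  pivot≢0 : addColumn M zero (suc c) 1ℚ zero zero ≢ 0ℚ
  pivot≢0 eq = entry≢0 (begin
    M zero (suc c)                      ≡⟨ simplify (M zero (suc c)) ⟨
    1ℚ * M zero (suc c) + 0ℚ            ≡⟨ cong (1ℚ * M zero (suc c) +_) (before≡0 zero) ⟨
    1ℚ * M zero (suc c) + M zero zero   ≡⟨ eq ⟩
    0ℚ                                  ∎)
    where
    simplify : ∀ x → 1ℚ * x + 0ℚ ≡ x
    simplify = solve-∀ ℚ-ring

trivialKernel⇒det≢0 : ∀ {n} (M : Matrix n) → TrivialKernel M → det M ≢ 0ℚ
trivialKernel⇒det≢0 M kernel with nonsingular-or-singular M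
... | inj₁ (det≢0 , _ , _)                 = det≢0
... | inj₂ (_ , (v , v-kernel , v≢0) , _) = λ _ → v≢0 (kernel v v-kernel)

det≢0⇒onto : ∀ {n} (M : Matrix n) → det M ≢ 0ℚ → Onto M
det≢0⇒onto M det≢0 with nonsingular-or-singular M
... | inj₁ (_ , _ , onto)    = onto
... | inj₂ (det≡0 , _ , _)   = ⊥-elim (det≢0 det≡0)

onto⇒trivialKernel : ∀ {n} (M : Matrix n) → Onto M → TrivialKernel M
onto⇒trivialKernel M onto with nonsingular-or-singular M
... | inj₁ (_ , kernel , _)             = kernel
... | inj₂ (_ , _ , (t , unsolvable))  = ⊥-elim (unsolvable (proj₁ (onto t)) (proj₂ (onto t)))

-- Block matrices

module CanonicalPairing {N n d} (N≡dn : N ≡ d ℕ.* n) where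

  N≡nd : N ≡ n ℕ.* d
  N≡nd = trans N≡dn (ℕP.*-comm d n)

  pair : Fin N → Fin n × Fin d
  pair b = Fin.remQuot d (Fin.cast N≡nd b)

  unpair : Fin n × Fin d → Fin N
  unpair (i , c) = Fin.cast (sym N≡nd) (Fin.combine i c)

  pair-unpair : ∀ x → pair (unpair x) ≡ x
  pair-unpair (i , c) = trans (cong (Fin.remQuot d) (FinP.cast-involutive N≡nd (sym N≡nd) (Fin.combine i c)))
                              (FinP.remQuot-combine i c)

  unpair-pair : ∀ b → unpair (pair b) ≡ b
  unpair-pair b = trans (cong (Fin.cast (sym N≡nd)) (FinP.combine-remQuot {n} d (Fin.cast N≡nd b)))
                        (FinP.cast-involutive (sym N≡nd) N≡nd b)

  pair-injective : Injective _≡_ _≡_ pair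
  pair-injective {b} {b′} eq = trans (sym (unpair-pair b)) (trans (cong unpair eq) (unpair-pair b′))

  Σℚ-pair : ∀ (g : Fin n × Fin d → ℚ) → Σℚ (g ∘ pair) ≡ Σℚ (λ i → Σℚ (λ c → g (i , c)))
  Σℚ-pair g = trans (Σℚ-cast N≡nd (g ∘ Fin.remQuot d))
    (trans (Σℚ-combine {n} {d} (g ∘ Fin.remQuot d))
           (Σℚ-cong λ i → Σℚ-cong λ c → cong g (FinP.remQuot-combine i c)))

Block : ℕ → ℕ → ℕ → Set
Block N n d = Fin N → Fin n → Fin d → ℚ

infix 8 _⊙_
_⊙_ : ∀ {N n d} → Block N n d → (Fin n → Fin d → ℚ) → Fin N → ℚ
(R ⊙ U) r = Σℚ (λ i → Σℚ (λ c → R r i c * U i c))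

BlockTrivialKernel BlockOnto : ∀ {N n d} → Block N n d → Set
BlockTrivialKernel R = ∀ U → (∀ r → (R ⊙ U) r ≡ 0ℚ) → ∀ i c → U i c ≡ 0ℚ
BlockOnto {N} {n} {d} R = ∀ (T : Fin N → ℚ) → Σ (Fin n → Fin d → ℚ) λ U → ∀ r → (R ⊙ U) r ≡ T r

-- The square submatrix with rows ρ and columns γ, whose determinant is a minor as in RankAtLeast.
flatten : ∀ {N n d} → Block N n d → (Fin N → Fin N) → (Fin N → Fin n × Fin d) → Matrix N
flatten R ρ γ a b = R (ρ a) (proj₁ (γ b)) (proj₂ (γ b))

module Reindexing {N n d} (N≡dn : N ≡ d ℕ.* n)
                  (γ : Fin N → Fin n × Fin d) (γ-inj : Injective _≡_ _≡_ γ) where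

  open CanonicalPairing {N} {n} {d} N≡dn

  π-inj : Injective _≡_ _≡_ (unpair ∘ γ)
  π-inj eq = γ-inj (trans (sym (pair-unpair _)) (trans (cong pair eq) (pair-unpair _)))

  γ⁻¹ : Fin n × Fin d → Fin N
  γ⁻¹ x = proj₁ (injective⇒surjective π-inj (unpair x))

  γ-γ⁻¹ : ∀ x → γ (γ⁻¹ x) ≡ x
  γ-γ⁻¹ x = trans (sym (pair-unpair _))
    (trans (cong pair (proj₂ (injective⇒surjective π-inj (unpair x)))) (pair-unpair x))

  γ⁻¹-γ : ∀ b → γ⁻¹ (γ b) ≡ b
  γ⁻¹-γ b = γ-inj (γ-γ⁻¹ (γ b))

  Σℚ-reindex : ∀ (g : Fin n × Fin d → ℚ) → Σℚ (g ∘ γ) ≡ Σℚ (λ i → Σℚ (λ c → g (i , c)))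
  Σℚ-reindex g = begin
    Σℚ (g ∘ γ)                       ≡⟨ Σℚ-cong (λ b → cong g (pair-unpair (γ b))) ⟨
    Σℚ (g ∘ pair ∘ unpair ∘ γ)       ≡⟨ Σℚ-permute π-inj (g ∘ pair) ⟩
    Σℚ (g ∘ pair)                    ≡⟨ Σℚ-pair g ⟩
    Σℚ (λ i → Σℚ (λ c → g (i , c)))  ∎

  flat : (Fin n → Fin d → ℚ) → Fin N → ℚ
  flat U b = U (proj₁ (γ b)) (proj₂ (γ b))

  unflat : (Fin N → ℚ) → Fin n → Fin d → ℚ
  unflat v i c = v (γ⁻¹ (i , c))

  flat-unflat : ∀ v b → flat (unflat v) b ≡ v b
  flat-unflat v b = cong v (γ⁻¹-γ b)

  unflat-flat : ∀ U i c → unflat (flat U) i c ≡ U i c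
  unflat-flat U i c = cong (λ x → U (proj₁ x) (proj₂ x)) (γ-γ⁻¹ (i , c))

  ·-flat : ∀ (R : Block N n d) ρ U a → (flatten R ρ γ · flat U) a ≡ (R ⊙ U) (ρ a)
  ·-flat R ρ U a = Σℚ-reindex (λ x → R (ρ a) (proj₁ x) (proj₂ x) * U (proj₁ x) (proj₂ x))

  ·-unflat : ∀ (R : Block N n d) ρ v a → (R ⊙ unflat v) (ρ a) ≡ (flatten R ρ γ · v) a
  ·-unflat R ρ v a = trans (sym (·-flat R ρ (unflat v) a)) (·-cong (flatten R ρ γ) (flat-unflat v) a)

  blockTrivialKernel⇒trivialKernel : ∀ (R : Block N n d) → BlockTrivialKernel R → TrivialKernel (flatten R id γ)
  blockTrivialKernel⇒trivialKernel R kernel v v-kernel b =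
    trans (sym (flat-unflat v b))
          (kernel (unflat v) (λ r → trans (·-unflat R id v r) (v-kernel r)) _ _)

  trivialKernel⇒blockTrivialKernel : ∀ (R : Block N n d) → TrivialKernel (flatten R id γ) → BlockTrivialKernel R
  trivialKernel⇒blockTrivialKernel R kernel U U-kernel i c =
    trans (sym (unflat-flat U i c)) (kernel (flat U) (λ a → trans (·-flat R id U a) (U-kernel a)) _)

  onto⇒blockOnto : ∀ (R : Block N n d) {ρ} → Injective _≡_ _≡_ ρ → Onto (flatten R ρ γ) → BlockOnto R
  onto⇒blockOnto R {ρ} ρ-inj onto T = unflat v , solves
    where
    v : Fin N → ℚ
    v = proj₁ (onto (T ∘ ρ))
    solves : ∀ r → (R ⊙ unflat v) r ≡ T r
    solves r with a , refl ← injective⇒surjective ρ-inj r =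
      trans (·-unflat R ρ v a) (proj₂ (onto (T ∘ ρ)) a)

  blockOnto⇒onto : ∀ (R : Block N n d) → BlockOnto R → Onto (flatten R id γ)
  blockOnto⇒onto R onto t = flat U , λ a → trans (·-flat R id U a) (proj₂ (onto t) a)
    where
    U : Fin n → Fin d → ℚ
    U = proj₁ (onto t)

blockOnto⇒blockTrivialKernel : ∀ {N n d} (R : Block N n d) → N ≡ d ℕ.* n → BlockOnto R → BlockTrivialKernel R
blockOnto⇒blockTrivialKernel {N} {n} {d} R N≡dn onto =
  trivialKernel⇒blockTrivialKernel R (onto⇒trivialKernel (flatten R id pair) (blockOnto⇒onto R onto))
  where
  open CanonicalPairing {N} {n} {d} N≡dn using (pair; pair-injective)
  open Reindexing N≡dn pair pair-injective

-- Rigidity matrices of pinned subgraphs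

extendAlong : ∀ {K N} → (Fin K → Fin N) → (Fin K → ℚ) → Fin N → ℚ
extendAlong σ t r with FinP.any? (λ k → σ k ≟ r)
... | yes (k , _) = t k
... | no _        = 0ℚ

extendAlong-σ : ∀ {K N} {σ : Fin K → Fin N} (t : Fin K → ℚ) → Injective _≡_ _≡_ σ →
                ∀ k → extendAlong σ t (σ k) ≡ t k
extendAlong-σ {σ = σ} t σ-inj k with FinP.any? (λ k′ → σ k′ ≟ σ k)
... | yes (k′ , σk′≡σk) = cong t (σ-inj σk′≡σk)
... | no ¬hit           = ⊥-elim (¬hit (k , refl))

lookup-removeAt : ∀ {A : Set} (xs : List A) (e r : Fin (length xs)) → r ≢ e →
                  ∃ λ r′ → lookup (removeAt xs e) r′ ≡ lookup xs r
lookup-removeAt (x List.∷ xs) zero    zero    r≢e = ⊥-elim (r≢e refl)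
lookup-removeAt (x List.∷ xs) zero    (suc r) _   = r , refl
lookup-removeAt (x List.∷ xs) (suc e) zero    _   = zero , refl
lookup-removeAt (x List.∷ xs) (suc e) (suc r) r≢e with r′ , eq ← lookup-removeAt xs e r (r≢e ∘ cong suc) =
  suc r′ , eq

isostatic⇒fullRank : ∀ d G q → SquareInvertible d G q → RankAtLeast d G q (length (edges G))
isostatic⇒fullRank d G q (N≡dn , kernel) =
  id , pair , id , pair-injective ,
  trivialKernel⇒det≢0 (flatten R id pair) (blockTrivialKernel⇒trivialKernel R kernel)
  where
  R : Block (length (edges G)) (nI G) d
  R = RigidityMatrix d G q
  open CanonicalPairing {d = d} N≡dn using (pair; pair-injective)
  open Reindexing N≡dn pair pair-injective using (blockTrivialKernel⇒trivialKernel)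

fullRank⇒onto : ∀ d G p → length (edges G) ≡ d ℕ.* nI G →
                RankAtLeast d G p (length (edges G)) → BlockOnto (RigidityMatrix d G p)
fullRank⇒onto d G p N≡dn (ρ , γ , ρ-inj , γ-inj , det≢0) =
  onto⇒blockOnto (RigidityMatrix d G p) ρ-inj (det≢0⇒onto _ det≢0)
  where
  open Reindexing N≡dn γ γ-inj using (onto⇒blockOnto)

generic-isostatic⇒onto : ∀ d G p → PinnedIsostatic d G → Generic d G p → BlockOnto (RigidityMatrix d G p)
generic-isostatic⇒onto d G p (_ , q , N≡dn , kernel) generic =
  fullRank⇒onto d G p N≡dn (generic q _ (isostatic⇒fullRank d G q (N≡dn , kernel)))

module Restriction {d : ℕ} {G H : PinnedGraph} (H⊆G : IsPinnedSubgraph H G) (p : Config d G) where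
  open IsPinnedSubgraph H⊆G

  p∣H : Config d H
  p∣H v = p (mapVertex ι κ v)

  contrib-inner : ∀ u w h c → contrib p (mapVertex ι κ u) (mapVertex ι κ w) (ι h) c ≡ contrib p∣H u w h c
  contrib-inner (inj₂ k) w h c = refl
  contrib-inner (inj₁ a) w h c with ι a ≟ ι h | a ≟ h
  ... | yes _     | yes _    = refl
  ... | yes ιa≡ιh | no a≢h   = ⊥-elim (a≢h (ι-inj ιa≡ιh))
  ... | no ιa≢ιh  | yes refl = ⊥-elim (ιa≢ιh refl)
  ... | no _      | no _     = refl

  contrib-outer : ∀ u w i c → (∀ h → ι h ≢ i) → contrib p (mapVertex ι κ u) (mapVertex ι κ w) i c ≡ 0ℚ
  contrib-outer (inj₂ k) w i c _ = refl
  contrib-outer (inj₁ a) w i c outside with ι a ≟ i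
  ... | yes ιa≡i = ⊥-elim (outside a ιa≡i)
  ... | no _     = refl

  rowEntry-inner : ∀ e h c → rowEntry p (mapEdge ι κ e) (ι h) c ≡ rowEntry p∣H e h c
  rowEntry-inner (u , w) h c = cong₂ _+_ (contrib-inner u w h c) (contrib-inner w u h c)

  rowEntry-outer : ∀ e i c → (∀ h → ι h ≢ i) → rowEntry p (mapEdge ι κ e) i c ≡ 0ℚ
  rowEntry-outer (u , w) i c outside = cong₂ _+_ (contrib-outer u w i c outside) (contrib-outer w u i c outside)

  ⊙-restrict : ∀ k (U : InnerVec d G) →
               (RigidityMatrix d H p∣H ⊙ (U ∘ ι)) k ≡ (RigidityMatrix d G p ⊙ U) (σ k)
  ⊙-restrict k U = begin
    (RigidityMatrix d H p∣H ⊙ (U ∘ ι)) k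
      ≡⟨ Σℚ-cong (λ h → Σℚ-cong (λ c → cong (_* U (ι h) c) (rowEntry-inner e h c))) ⟨
    Σℚ (λ h → Σℚ (λ c → rowEntry p (mapEdge ι κ e) (ι h) c * U (ι h) c))
      ≡⟨ Σℚ-image ι ι-inj _ (λ i outside → Σℚ-zero λ c →
           trans (cong (_* U i c) (rowEntry-outer e i c outside)) (ℚP.*-zeroˡ (U i c))) ⟨
    Σℚ (λ i → Σℚ (λ c → rowEntry p (mapEdge ι κ e) i c * U i c))
      ≡⟨ cong (λ e′ → Σℚ (λ i → Σℚ (λ c → rowEntry p e′ i c * U i c))) (σ-ok k) ⟨
    (RigidityMatrix d G p ⊙ U) (σ k) ∎
    where
    e : Edge (nI H) (nP H)
    e = lookup (edges H) k

  onto-restrict : BlockOnto (RigidityMatrix d G p) → BlockOnto (RigidityMatrix d H p∣H)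
  onto-restrict onto t = U ∘ ι , λ k →
    trans (⊙-restrict k U) (trans (proj₂ (onto (extendAlong σ t)) (σ k)) (extendAlong-σ t σ-inj k))
    where
    U : InnerVec d G
    U = proj₁ (onto (extendAlong σ t))

  motion-restrict : ∀ e → (∀ k → σ k ≢ e) → ∀ U →
                    IsInfMotion d (G -ᵉ e) p U → IsInfMotion d H p∣H (U ∘ ι)
  motion-restrict e e∉σ U motion k with r′ , same-edge ← lookup-removeAt (edges G) e (σ k) (e∉σ k) =
    trans (⊙-restrict k U)
          (trans (cong (λ e′ → Σℚ (λ i → Σℚ (λ c → rowEntry p e′ i c * U i c))) (sym same-edge))
                 (motion r′))

  motion-vanishes : BlockOnto (RigidityMatrix d G p) → length (edges H) ≡ d ℕ.* nI H →
                    ∀ e → (∀ k → σ k ≢ e) → ∀ U → IsInfMotion d (G -ᵉ e) p U →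
                    ∀ h c → U (ι h) c ≡ 0ℚ
  motion-vanishes onto K≡dm e e∉σ U motion =
    blockOnto⇒blockTrivialKernel (RigidityMatrix d H p∣H) K≡dm (onto-restrict onto) (U ∘ ι)
      (motion-restrict e e∉σ U motion)

noProperIsostaticSubgraph : ∀ d → 1 ≤ d → (G : PinnedGraph) → PinnedIsostatic d G →
  (p : Config d G) → Generic d G p →
  (∀ e → Σ (InnerVec d G) λ U → IsInfMotion d (G -ᵉ e) p U × (∀ i → NonzeroVec (U i))) →
  ¬ (Σ PinnedGraph λ H → IsPinnedSubgraph H G × 0 ℕ.< nI H × nI H ℕ.< nI G × PinnedIsostatic d H)
noProperIsostaticSubgraph d 1≤d G isostatic@(_ , _ , N≡dn , _) p generic motions
  (H , H⊆G , 0<m , m<n , (_ , _ , K≡dm , _)) =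
  let e , e∉σ            = injective-<⇒avoids σ-inj K<N
      U , motion , nonzero = motions e
      c , Uc≢0             = nonzero (ι h₀)
  in Uc≢0 (motion-vanishes (generic-isostatic⇒onto d G p isostatic generic) K≡dm e e∉σ U motion h₀ c)
  where
  open IsPinnedSubgraph H⊆G
  open Restriction H⊆G p
  instance _ = ℕ.>-nonZero 1≤d
  K<N : length (edges H) ℕ.< length (edges G)
  K<N = subst₂ ℕ._<_ (sym K≡dm) (sym N≡dn) (ℕP.*-monoʳ-< d m<n)
  h₀ : Fin (nI H)
  h₀ = fromℕ< 0<m

proposition4p1 : (d : ℕ) → 1 ≤ d → (G : PinnedGraph) →
    PinnedIsostatic d G → (p : Config d G) → Generic d G p →
    (∀ (e : Fin (length (edges G))) → Σ (InnerVec d G) λ U →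
       IsInfMotion d (G -ᵉ e) p U × (∀ i → NonzeroVec (U i))) →
    IsStronglyAssur d G
proposition4p1 d 1≤d G isostatic p generic motions =
  (isostatic , noProperIsostaticSubgraph d 1≤d G isostatic p generic motions) , p , generic , motions
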